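{- Let $G$ be a graph, let $F\subseteq\binom{V(G)}{2}\setminus E(G)$ be such that $(V(G),E(G)\cup F)$ is an interval graph, and let $A\subseteq V(G)$. Then $V(G)\setminus A$ has at most $(2|A|+1)^2+|F|$ neighborhood classes with respect to $A$. In particular, if $(G,k)$ is a YES-instance of \textsc{Interval Completion}, then there are at most $(2|A|+1)^2+k$ neighborhood classes with respect to $A$.
   Context: Two vertices $v_1,v_2\notin A$ have the same neighborhood with respect to $A$ if $N_G(v_1)\cap A=N_G(v_2)\cap A$; the equivalence classes of this relation on $V(G)\setminus A$ are the neighborhood classes with respect to $A$. $(G,k)$ is a YES-instance of \textsc{Interval Completion} if one can add at most $k$ edges to $G$ to obtain an interval graph. -}

module Defs where

open import Data.Nat using (ℕ; _≤_; _+_; _*_; _^_)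
open import Data.Fin using (Fin)
open import Data.Fin.Subset using (Subset; _∈_; _∉_; ∣_∣)
open import Data.Fin.Subset.Properties using (_∈?_)
open import Data.Bool using (Bool; true; false; _∨_; _∧_)
open import Data.Vec using (Vec; tabulate; lookup)
open import Data.Vec.Properties using (≡-dec)
open import Data.Bool.Properties using () renaming (_≟_ to _≟ᵇ_)
open import Data.List using (List; length; map; filter; deduplicate; allFin)
open import Data.List.Membership.Propositional using () renaming (_∈_ to _∈ˡ_)
open import Data.List.Relation.Unary.All using (All)
open import Data.List.Relation.Unary.AllPairs using (AllPairs)
open import Data.Product using (Σ; _×_; _,_; ∃; proj₁; proj₂)
open import Data.Sum using (_⊎_)
open import Relation.Nullary using (¬_; Dec)
open import Relation.Nullary.Decidable using (¬?)
open import Relation.Binary.PropositionalEquality using (_≡_; _≢_)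
open import Function.Bundles using (_⇔_)

record Graph (n : ℕ) : Set where
  field
    adj    : Fin n → Fin n → Bool
    sym    : ∀ u v → adj u v ≡ adj v u
    irrefl : ∀ v → adj v v ≡ false
open Graph public

Edge : ∀ {n} → Graph n → Fin n → Fin n → Set
Edge G u v = adj G u v ≡ true

-- A graph is an interval graph if every vertex can be assigned a closed
-- interval [l v , r v] of the line such that distinct vertices are adjacent
-- iff their intervals intersect.  (For finite graphs, integer endpoints are
-- without loss of generality.)
IsIntervalGraph : ∀ {n} → Graph n → Set
IsIntervalGraph {n} G =
  Σ (Fin n → ℕ) λ l → Σ (Fin n → ℕ) λ r →
    (∀ v → l v ≤ r v) ×
    (∀ u v → u ≢ v → (Edge G u v ⇔ (l u ≤ r v × l v ≤ r u)))

SamePair : ∀ {n} → (Fin n × Fin n) → (Fin n × Fin n) → Set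
SamePair (a , b) (c , d) = (a ≡ c × b ≡ d) ⊎ (a ≡ d × b ≡ c)

-- F ⊆ binom(V(G),2) \ E(G), represented as a duplicate-free list of
-- unordered pairs {u,v} (u ≠ v, non-adjacent in G); |F| = length F.
IsNonEdgeSet : ∀ {n} → Graph n → List (Fin n × Fin n) → Set
IsNonEdgeSet G F =
  All (λ p → proj₁ p ≢ proj₂ p × adj G (proj₁ p) (proj₂ p) ≡ false) F ×
  AllPairs (λ p q → ¬ SamePair p q) F

open import Data.Fin using (_≟_)
open import Data.Bool.ListAction using (any)
open import Relation.Nullary.Decidable using (⌊_⌋)

inPairs : ∀ {n} → List (Fin n × Fin n) → Fin n → Fin n → Bool
inPairs F u v = any (λ p → (⌊ proj₁ p ≟ u ⌋ ∧ ⌊ proj₂ p ≟ v ⌋) ∨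
                           (⌊ proj₁ p ≟ v ⌋ ∧ ⌊ proj₂ p ≟ u ⌋)) F

open import Data.Bool.Properties using (∨-comm; ∧-comm)

addEdges : ∀ {n} (G : Graph n) (F : List (Fin n × Fin n)) →
           IsNonEdgeSet G F → Graph n
addEdges {n} G F hF = record
  { adj = λ u v → adj G u v ∨ inPairs F u v
  ; sym = symP
  ; irrefl = irr }
  where
    open import Relation.Binary.PropositionalEquality using (cong₂; refl; cong)
    symI : ∀ (L : List (Fin n × Fin n)) u v → inPairs L u v ≡ inPairs L v u
    symI Data.List.[] u v = refl
    symI (p Data.List.∷ L) u v =
      cong₂ _∨_ (∨-comm (⌊ proj₁ p ≟ u ⌋ ∧ ⌊ proj₂ p ≟ v ⌋) _) (symI L u v)
    symP : ∀ u v → (adj G u v ∨ inPairs F u v) ≡ (adj G v u ∨ inPairs F v u)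
    symP u v = cong₂ _∨_ (sym G u v) (symI F u v)
    irrI : ∀ (L : List (Fin n × Fin n)) → All (λ p → proj₁ p ≢ proj₂ p × adj G (proj₁ p) (proj₂ p) ≡ false) L
           → ∀ v → inPairs L v v ≡ false
    irrI Data.List.[] _ v = refl
    irrI ((a , b) Data.List.∷ L) (All._∷_ (a≢b , _) h) v
      with a ≟ v | b ≟ v
    ... | Relation.Nullary.yes refl | Relation.Nullary.yes refl =
          Data.Empty.⊥-elim (a≢b refl) where import Data.Empty
    ... | Relation.Nullary.yes _ | Relation.Nullary.no _ = irrI L h v
    ... | Relation.Nullary.no _ | Relation.Nullary.yes _ = irrI L h v
    ... | Relation.Nullary.no _ | Relation.Nullary.no _ = irrI L h v
    irr : ∀ v → (adj G v v ∨ inPairs F v v) ≡ false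
    irr v rewrite irrefl G v = irrI F (proj₁ hF) v

nbhdIn : ∀ {n} → Graph n → Subset n → Fin n → Subset n
nbhdIn G A v = tabulate λ u → lookup A u ∧ adj G v u

outside : ∀ {n} → Subset n → List (Fin n)
outside {n} A = filter (λ v → ¬? (v ∈? A)) (allFin n)

numNbhdClasses : ∀ {n} → Graph n → Subset n → ℕ
numNbhdClasses G A = length (deduplicate (≡-dec _≟ᵇ_) (map (nbhdIn G A) (outside A)))

IntervalCompletionYes : ∀ {n} → Graph n → ℕ → Set
IntervalCompletionYes G k =
  Σ _ λ F → Σ (IsNonEdgeSet G F) λ hF → length F ≤ k × IsIntervalGraph (addEdges G F hF)

{-# OPTIONS --safe #-}
-- Fix an interval model (l , r) of G + F.  A vertex v ∉ A that meets no pair of F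
-- with its other end in A has N(v) ∩ A = {u ∈ A | l u ≤ r v and l v ≤ r u}; each of
-- the two conditions cuts A at one of |A| + 1 thresholds (read off the endpoints of
-- the intervals of A), so such v realise at most (|A| + 1)² ≤ (2|A| + 1)² sets.  Every
-- other v ∉ A is the endpoint outside A of some pair of F, giving at most |F| more.

module Submission where

open import Defs hiding (sym)
open import Data.Nat using (ℕ; _≤_; _+_; _*_; _^_)
open import Data.Fin.Subset using (Subset; ∣_∣)
open import Data.List using (List; length)
open import Data.Fin using (Fin)
open import Data.Product using (_×_)

open import Data.Bool using (true; false; _∧_; _∨_; T)
open import Data.Bool.Properties using (∨-identityʳ; T-≡; T-∧; T-∨) renaming (_≟_ to _≟ᵇ_)
open import Data.Fin using (zero; suc; _≟_)
open import Data.Fin.Properties using (any?)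
open import Data.Fin.Subset using (_∈_; _∉_)
open import Data.Fin.Subset.Properties using (_∈?_)
open import Data.List using ([]; _∷_; _++_; map; filter; deduplicate; allFin; cartesianProductWith)
open import Data.List.Extrema.Nat using (max; argmax-sel; max≤v⁺; xs≤max)
open import Data.List.Membership.Propositional using () renaming (_∈_ to _∈ˡ_)
open import Data.List.Membership.Propositional.Properties
  using ( ∈-map⁺; ∈-map⁻; ∈-filter⁺; ∈-filter⁻; ∈-++⁺ˡ; ∈-++⁺ʳ
        ; ∈-cartesianProductWith⁺; ∈-deduplicate⁻)
open import Data.List.Properties using (length-++; length-map; filter-notAll)
open import Data.List.Relation.Binary.Subset.Propositional using (_⊆_)
open import Data.List.Relation.Unary.All as All using ()
open import Data.List.Relation.Unary.All.Properties using (all-filter)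
open import Data.List.Relation.Unary.Any as Any using (Any; here; there)
open import Data.List.Relation.Unary.Any.Properties using (any⁻; map⁺)
open import Data.List.Relation.Unary.AllPairs using (_∷_)
open import Data.List.Relation.Unary.Unique.Propositional using (Unique)
open import Data.List.Relation.Unary.Unique.DecPropositional.Properties using (deduplicate-!)
open import Data.Nat using (suc; z≤n; s≤s; _≤?_)
open import Data.Nat.Properties
  using ( module ≤-Reasoning; ≤-trans; ≮⇒≥; ≤⇒≯; *-mono-≤; +-monoˡ-≤; +-monoʳ-≤
        ; +-comm; m≤m+n; *-identityʳ)
open import Data.Product as Product using (∃-syntax; _,_; proj₁; proj₂)
open import Data.Sum as Sum using (inj₁; inj₂)
open import Data.Vec using ([]; _∷_; here; there; lookup; tabulate)
open import Data.Vec.Properties using (≡-dec; tabulate-cong; lookup⇒[]=)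
open import Function using (_∘_; _⇔_; mk⇔; Equivalence)
open import Relation.Binary.Definitions using (DecidableEquality)
open import Relation.Binary.PropositionalEquality
  using (_≡_; _≢_; refl; sym; trans; cong; cong₂; subst; module ≡-Reasoning)
open import Relation.Nullary using (¬_; Dec; yes; no; does; proof; ¬?; contradiction)
open import Relation.Nullary.Decidable using (_×-dec_; T?; map′; toWitness; ⌊_⌋)
open import Relation.Nullary.Reflects using (Reflects; det; fromEquivalence)

private
  variable
    X : Set

unique-⊆⇒length≤ : DecidableEquality X → {xs ys : List X} →
                    Unique xs → xs ⊆ ys → length xs ≤ length ys
unique-⊆⇒length≤ _≟_ {[]}     _              _      = z≤n
unique-⊆⇒length≤ _≟_ {x ∷ xs} {ys} (x∉xs ∷ !xs) xs⊆ys =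
  ≤-trans (s≤s (unique-⊆⇒length≤ _≟_ !xs xs⊆ys-x))
          (filter-notAll (¬? ∘ (x ≟_)) ys (Any.map (λ x≡y x≢y → x≢y x≡y) (xs⊆ys (here refl))))
  where
  xs⊆ys-x : xs ⊆ filter (¬? ∘ (x ≟_)) ys
  xs⊆ys-x z∈xs = ∈-filter⁺ (¬? ∘ (x ≟_)) (xs⊆ys (there z∈xs)) (All.lookup x∉xs z∈xs)

length-deduplicate-≤ : (_≟_ : DecidableEquality X) {xs ys : List X} →
                       xs ⊆ ys → length (deduplicate _≟_ xs) ≤ length ys
length-deduplicate-≤ _≟_ {xs} xs⊆ys =
  unique-⊆⇒length≤ _≟_ (deduplicate-! _≟_ xs) (xs⊆ys ∘ ∈-deduplicate⁻ _≟_ xs)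

length-cartesianProductWith : {Y Z : Set} (f : X → Y → Z) (xs : List X) (ys : List Y) →
                              length (cartesianProductWith f xs ys) ≡ length xs * length ys
length-cartesianProductWith f []       ys = refl
length-cartesianProductWith f (x ∷ xs) ys = begin
  length (map (f x) ys ++ cartesianProductWith f xs ys)
    ≡⟨ length-++ (map (f x) ys) ⟩
  length (map (f x) ys) + length (cartesianProductWith f xs ys)
    ≡⟨ cong₂ _+_ (length-map (f x) ys) (length-cartesianProductWith f xs ys) ⟩
  length ys + length xs * length ys
    ∎
  where open ≡-Reasoning

-- c is the largest key not exceeding t, or 0 if there is none.
≤-threshold : (f : X → ℕ) (t : ℕ) (xs : List X) →
              ∃[ c ] c ∈ˡ 0 ∷ map f xs × (∀ {x} → x ∈ˡ xs → f x ≤ t ⇔ f x ≤ c)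
≤-threshold f t xs = c , c∈0∷fxs , λ x∈xs → mk⇔ (fx≤c x∈xs) (λ fx≤c → ≤-trans fx≤c c≤t)
  where
  keys = filter (_≤? t) (map f xs)
  c    = max 0 keys

  c∈0∷fxs : c ∈ˡ 0 ∷ map f xs
  c∈0∷fxs with argmax-sel (λ k → k) 0 keys
  ... | inj₁ c≡0    = here c≡0
  ... | inj₂ c∈keys = there (proj₁ (∈-filter⁻ (_≤? t) c∈keys))

  c≤t : c ≤ t
  c≤t = max≤v⁺ z≤n (all-filter (_≤? t) (map f xs))

  fx≤c : ∀ {x} → x ∈ˡ xs → f x ≤ t → f x ≤ c
  fx≤c x∈xs fx≤t = All.lookup (xs≤max 0 keys) (∈-filter⁺ (_≤? t) (∈-map⁺ f x∈xs) fx≤t)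

≥-threshold : (f : X → ℕ) (t : ℕ) (xs : List X) →
              ∃[ c ] c ∈ˡ 0 ∷ map (suc ∘ f) xs × (∀ {x} → x ∈ˡ xs → t ≤ f x ⇔ c ≤ f x)
-- t ≤ f x is the negation of suc (f x) ≤ t, a threshold condition on the keys suc ∘ f.
≥-threshold f t xs with ≤-threshold (suc ∘ f) t xs
... | c , c∈ , f<t⇔f<c = c , c∈ , λ x∈xs →
  let open Equivalence (f<t⇔f<c x∈xs) in
  mk⇔ (λ t≤fx → ≮⇒≥ (≤⇒≯ t≤fx ∘ from)) (λ c≤fx → ≮⇒≥ (≤⇒≯ c≤fx ∘ to))

members : ∀ {n} → Subset n → List (Fin n)
members []            = []
members (true  ∷ p)   = zero ∷ map suc (members p)
members (false ∷ p)   = map suc (members p)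

length-members : ∀ {n} (p : Subset n) → length (members p) ≡ ∣ p ∣
length-members []          = refl
length-members (true  ∷ p) = cong suc (trans (length-map suc (members p)) (length-members p))
length-members (false ∷ p) = trans (length-map suc (members p)) (length-members p)

∈-members : ∀ {n} {x : Fin n} {p : Subset n} → x ∈ p → x ∈ˡ members p
∈-members {p = true  ∷ p} here        = here refl
∈-members {p = true  ∷ p} (there x∈p) = there (∈-map⁺ suc (∈-members x∈p))
∈-members {p = false ∷ p} (there x∈p) = ∈-map⁺ suc (∈-members x∈p)

does-cong : ∀ {P Q : Set} → P ⇔ Q → (P? : Dec P) (Q? : Dec Q) → does P? ≡ does Q?
does-cong P⇔Q P? Q? = det (proof (map′ to from P?)) (proof Q?)
  where open Equivalence P⇔Q

inPairs⇒SamePair : ∀ {n} (F : List (Fin n × Fin n)) {u v} →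
                   T (inPairs F u v) → Any (λ p → SamePair p (u , v)) F
inPairs⇒SamePair F = Any.map (λ {p} → samePair p) ∘ any⁻ _ F
  where
  witnesses : ∀ {n} {a b c d : Fin n} → T (⌊ a ≟ b ⌋ ∧ ⌊ c ≟ d ⌋) → a ≡ b × c ≡ d
  witnesses {a = a} {b} {c} {d} =
    Product.map toWitness toWitness ∘ Equivalence.to (T-∧ {⌊ a ≟ b ⌋} {⌊ c ≟ d ⌋})
  samePair : ∀ {n} {u v : Fin n} p → T ((⌊ proj₁ p ≟ u ⌋ ∧ ⌊ proj₂ p ≟ v ⌋) ∨
                                        (⌊ proj₁ p ≟ v ⌋ ∧ ⌊ proj₂ p ≟ u ⌋)) → SamePair p (u , v)
  samePair p = Sum.map witnesses witnesses ∘ Equivalence.to T-∨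

adj-addEdges : ∀ {n} (G : Graph n) {F} (hF : IsNonEdgeSet G F) {u v} →
               ¬ T (inPairs F u v) → adj (addEdges G F hF) u v ≡ adj G u v
adj-addEdges G {F} hF {u} {v} ∉F with inPairs F u v
... | false = ∨-identityʳ (adj G u v)
... | true  = contradiction _ ∉F

module NeighbourhoodClasses
  {n} (G : Graph n) {F : List (Fin n × Fin n)} (hF : IsNonEdgeSet G F)
  (l r : Fin n → ℕ)
  (edge⇔overlap : ∀ u v → u ≢ v → Edge (addEdges G F hF) u v ⇔ (l u ≤ r v × l v ≤ r u))
  (A : Subset n)
  where

  adj-reflects-overlap : ∀ {u v} → u ≢ v →
                         Reflects (l u ≤ r v × l v ≤ r u) (adj (addEdges G F hF) u v)
  adj-reflects-overlap u≢v =
    fromEquivalence (to ∘ Equivalence.to T-≡) (Equivalence.from T-≡ ∘ from)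
    where open Equivalence (edge⇔overlap _ _ u≢v)

  window : ℕ → ℕ → Subset n
  window s e = tabulate λ u → lookup A u ∧ does ((e ≤? r u) ×-dec (l u ≤? s))

  starts ends : List ℕ
  starts = 0 ∷ map l (members A)
  ends   = 0 ∷ map (suc ∘ r) (members A)

  windows : List (Subset n)
  windows = cartesianProductWith window starts ends

  length-windows : length windows ≡ suc ∣ A ∣ * suc ∣ A ∣
  length-windows = trans (length-cartesianProductWith window starts ends)
                         (cong₂ _*_ (length-0∷ l) (length-0∷ (suc ∘ r)))
    where
    length-0∷ : (f : Fin n → ℕ) → length (0 ∷ map f (members A)) ≡ suc ∣ A ∣
    length-0∷ f = cong suc (trans (length-map f (members A)) (length-members A))

  nbhdIn-∈-windows : ∀ {v} → v ∉ A → (∀ {u} → u ∈ A → ¬ T (inPairs F v u)) →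
                     nbhdIn G A v ∈ˡ windows
  nbhdIn-∈-windows {v} v∉A vA∉F
    with ≤-threshold l (r v) (members A) | ≥-threshold r (l v) (members A)
  ... | s , s∈ , ≤r[v]⇔≤s | e , e∈ , l[v]≤⇔e≤ =
    subst (_∈ˡ windows) (sym (tabulate-cong agree)) (∈-cartesianProductWith⁺ window s∈ e∈)
    where
    agree : ∀ u → (lookup A u ∧ adj G v u) ≡ (lookup A u ∧ does ((e ≤? r u) ×-dec (l u ≤? s)))
    agree u with lookup A u in Au
    ... | false = refl
    ... | true  = begin
      adj G v u                              ≡⟨ sym (adj-addEdges G hF (vA∉F u∈A)) ⟩
      adj (addEdges G F hF) v u              ≡⟨ det (adj-reflects-overlap v≢u) (proof overlap?) ⟩
      does overlap?                          ≡⟨ cong₂ _∧_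
          (does-cong (l[v]≤⇔e≤ u∈members) (l v ≤? r u) (e ≤? r u))
          (does-cong (≤r[v]⇔≤s u∈members) (l u ≤? r v) (l u ≤? s)) ⟩
      does ((e ≤? r u) ×-dec (l u ≤? s))     ∎
      where
      open ≡-Reasoning
      u∈A = lookup⇒[]= u A Au
      u∈members = ∈-members u∈A
      overlap? = (l v ≤? r u) ×-dec (l u ≤? r v)
      v≢u : v ≢ u
      v≢u refl = v∉A u∈A

  outerEnd : Fin n × Fin n → Fin n
  outerEnd (a , b) with a ∈? A
  ... | yes _ = b
  ... | no  _ = a

  outerEnd-SamePair : ∀ {p u v} → v ∉ A → u ∈ A → SamePair p (v , u) → outerEnd p ≡ v
  outerEnd-SamePair {a , b} v∉A u∈A (inj₁ (refl , refl)) with a ∈? A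
  ... | yes a∈A = contradiction a∈A v∉A
  ... | no  _   = refl
  outerEnd-SamePair {a , b} v∉A u∈A (inj₂ (refl , refl)) with a ∈? A
  ... | yes _   = refl
  ... | no  a∉A = contradiction u∈A a∉A

  nbhdIn-∈-outerEnds : ∀ {u v} → v ∉ A → u ∈ A → T (inPairs F v u) →
                       nbhdIn G A v ∈ˡ map (nbhdIn G A ∘ outerEnd) F
  nbhdIn-∈-outerEnds v∉A u∈A vu∈F = map⁺ (Any.map
    (λ vu≈p → cong (nbhdIn G A) (sym (outerEnd-SamePair v∉A u∈A vu≈p)))
    (inPairs⇒SamePair F vu∈F))

  nbhdIn-∈-classes : ∀ {v} → v ∉ A → nbhdIn G A v ∈ˡ windows ++ map (nbhdIn G A ∘ outerEnd) F
  nbhdIn-∈-classes {v} v∉A with any? (λ u → (u ∈? A) ×-dec T? (inPairs F v u))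
  ... | yes (u , u∈A , vu∈F) = ∈-++⁺ʳ windows (nbhdIn-∈-outerEnds v∉A u∈A vu∈F)
  ... | no  vA∉F             = ∈-++⁺ˡ (nbhdIn-∈-windows v∉A (λ u∈A vu∈F → vA∉F (_ , u∈A , vu∈F)))

  numNbhdClasses-≤ : numNbhdClasses G A ≤ suc ∣ A ∣ * suc ∣ A ∣ + length F
  numNbhdClasses-≤ = begin
    numNbhdClasses G A
      ≤⟨ length-deduplicate-≤ (≡-dec _≟ᵇ_) classes ⟩
    length (windows ++ map (nbhdIn G A ∘ outerEnd) F)
      ≡⟨ length-++ windows ⟩
    length windows + length (map (nbhdIn G A ∘ outerEnd) F)
      ≡⟨ cong₂ _+_ length-windows (length-map _ F) ⟩
    suc ∣ A ∣ * suc ∣ A ∣ + length F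
      ∎
    where
    open ≤-Reasoning
    classes : map (nbhdIn G A) (outside A) ⊆ windows ++ map (nbhdIn G A ∘ outerEnd) F
    classes N∈ with ∈-map⁻ (nbhdIn G A) N∈
    ... | v , v∈outside , refl =
      nbhdIn-∈-classes (proj₂ (∈-filter⁻ (λ w → ¬? (w ∈? A)) {xs = allFin n} v∈outside))

suc-square-≤ : ∀ m → suc m * suc m ≤ (2 * m + 1) ^ 2
suc-square-≤ m = subst (suc m * suc m ≤_) (cong ((2 * m + 1) *_) (sym (*-identityʳ (2 * m + 1))))
                   (*-mono-≤ 1+m≤2m+1 1+m≤2m+1)
  where
  1+m≤2m+1 : suc m ≤ 2 * m + 1
  1+m≤2m+1 = subst (suc m ≤_) (+-comm 1 (2 * m)) (s≤s (m≤m+n m (m + 0)))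

numNbhdClasses-≤-completion :
  ∀ n (G : Graph n) (F : List (Fin n × Fin n)) (hF : IsNonEdgeSet G F) →
  IsIntervalGraph (addEdges G F hF) → (A : Subset n) →
  numNbhdClasses G A ≤ (2 * ∣ A ∣ + 1) ^ 2 + length F
numNbhdClasses-≤-completion n G F hF (l , r , _ , edge⇔overlap) A =
  ≤-trans (NeighbourhoodClasses.numNbhdClasses-≤ G hF l r edge⇔overlap A)
          (+-monoˡ-≤ (length F) (suc-square-≤ ∣ A ∣))

mainTheorem10 :
    ((n : ℕ) (G : Graph n) (F : List (Fin n × Fin n)) (hF : IsNonEdgeSet G F) →
      IsIntervalGraph (addEdges G F hF) → (A : Subset n) →
      numNbhdClasses G A ≤ ((2 * ∣ A ∣ + 1) ^ 2 + length F))
    ×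
    ((n : ℕ) (G : Graph n) (k : ℕ) (A : Subset n) →
      IntervalCompletionYes G k →
      numNbhdClasses G A ≤ (2 * ∣ A ∣ + 1) ^ 2 + k)
mainTheorem10 =
  numNbhdClasses-≤-completion ,
  λ n G k A (F , hF , |F|≤k , interval) →
    ≤-trans (numNbhdClasses-≤-completion n G F hF interval A)
            (+-monoʳ-≤ ((2 * ∣ A ∣ + 1) ^ 2) |F|≤k)
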